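{- Let $G$ be a median graph with basepoint $v_0$. For every $m\in V$, $$\Upsilon(m)=\max\{\varphi(m,L)+\varphi(m,L^*) : L,L^* \text{ POFs outgoing from } m,\ L\cap L^*=\emptyset\},$$ and consequently $$\mathrm{diam}(G)=\max_{m\in V}\ \max\{\varphi(m,L)+\varphi(m,L^*) : L,L^* \text{ POFs outgoing from } m,\ L\cap L^*=\emptyset\}.$$
   Context: $G=(V,E)$ is a finite, simple, connected, undirected median graph: for all vertices $x,y,z$ the set $I(x,y)\cap I(y,z)\cap I(z,x)$ has exactly one element $m(x,y,z)$, where $I(u,v)=\{w: d(u,w)+d(w,v)=d(u,v)\}$. Edges $uv,xy$ are in relation $\Theta_0$ if $uvyx$ is a 4-cycle; $\Theta$ is the reflexive transitive closure of $\Theta_0$, with equivalence classes ($\Theta$-classes). For each class, removing its edges leaves exactly two components (halfspaces). Classes $E_i,E_j$ are orthogonal if there is a 4-cycle $uvyx$ with $uv,xy\in E_i$, $ux,vy\in E_j$; a POF is a set of classes any two distinct members of which are orthogonal (the empty set included). Each edge $xy$ is oriented from $x$ to $y$ when $d(v_0,x)<d(v_0,y)$; a POF $L$ is outgoing from $m$ if every class of $L$ has an edge oriented out of $m$. The signature $\sigma_{x,y}$ is the set of classes separating $x$ and $y$; for $x\in I(v_0,y)$, the ladder set $L_{x,y}$ is the set of classes in $\sigma_{x,y}$ having an edge incident to $x$. For $m\in V$ and a POF $L$ outgoing from $m$, $\varphi(m,L)=\max\{d(m,v): m\in I(v_0,v),\ L_{m,v}=L\}$. For $m\in V$, $\Upsilon(m)=\max\{d(u,v):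 u,v\in V,\ m(u,v,v_0)=m\}$. $\mathrm{diam}(G)=\max_{u,v}d(u,v)$. -}

module Defs where

open import Level using (Level; _⊔_) renaming (suc to lsuc; zero to lzero)
open import Data.Nat using (ℕ; zero; suc; _+_; _≤_; _<_)
open import Data.Fin using (Fin)
open import Data.Bool using (Bool; T)
open import Data.Product using (Σ; ∃; ∃-syntax; _×_; _,_)
open import Relation.Nullary using (¬_)
open import Relation.Binary.PropositionalEquality using (_≡_; _≢_)

record Graph : Set where
  field
    n       : ℕ
    adj     : Fin n → Fin n → Bool
    irrefl  : ∀ u → ¬ T (adj u u)
    sym     : ∀ u v → T (adj u v) → T (adj v u)

IsMax : ∀ {ℓ} → (ℕ → Set ℓ) → ℕ → Set ℓ
IsMax P k = P k × (∀ j → P j → j ≤ k)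

module _ (G : Graph) where
  open Graph G

  V : Set
  V = Fin n

  Adj : V → V → Set
  Adj u v = T (adj u v)

  data Walk : V → V → ℕ → Set where
    here : ∀ {u} → Walk u u 0
    step : ∀ {u w v k} → Adj u w → Walk w v k → Walk u v (suc k)

  Connected : Set
  Connected = ∀ u v → ∃[ k ] Walk u v k

  Dist : V → V → ℕ → Set
  Dist u v k = Walk u v k × (∀ j → Walk u v j → k ≤ j)

  InI : V → V → V → Set
  InI u v w = ∃[ a ] ∃[ b ] ∃[ c ] (Dist u w a × Dist w v b × Dist u v c × a + b ≡ c)

  Med : V → V → V → V → Set
  Med x y z w = InI x y w × InI y z w × InI z x w

  IsMedianGraph : Set
  IsMedianGraph = Connected ×
    (∀ x y z → ∃[ w ] (Med x y z w × (∀ w' → Med x y z w' → w' ≡ w)))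

  -- edges, as ordered pairs of adjacent vertices (uv and vu denote the same edge)
  Edge : Set
  Edge = Σ V λ u → Σ V λ v → Adj u v

  Cycle4 : V → V → V → V → Set
  Cycle4 u v y x = Adj u v × Adj v y × Adj y x × Adj x u × u ≢ y × v ≢ x

  Θ₀ : Edge → Edge → Set
  Θ₀ (u , v , _) (x , y , _) = Cycle4 u v y x

  -- Θ: reflexive-transitive closure of Θ₀ (on unordered edges: an edge is
  -- identified with its reversal)
  data Θ : Edge → Edge → Set where
    θ-refl : ∀ {e} → Θ e e
    θ-flip : ∀ {u v} (p : Adj u v) (q : Adj v u) → Θ (u , v , p) (v , u , q)
    θ-step : ∀ {e f g} → Θ₀ e f → Θ f g → Θ e g
    θ-sym  : ∀ {e f} → Θ e f → Θ f e
    θ-trans : ∀ {e f g} → Θ e f → Θ f g → Θ e g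

  data WalkAvoid (e : Edge) : V → V → Set where
    here : ∀ {u} → WalkAvoid e u u
    step : ∀ {u w v} (p : Adj u w) → ¬ Θ (u , w , p) e → WalkAvoid e w v → WalkAvoid e u v

  -- the Θ-class of e separates x and y (they lie in different halfspaces)
  Separates : Edge → V → V → Set
  Separates e x y = ¬ WalkAvoid e x y

  -- sets of Θ-classes are represented as Θ-closed predicates on edges
  ClassSet : Set₁
  ClassSet = Edge → Set

  IsClassSet : ClassSet → Set
  IsClassSet L = ∀ e f → L e → Θ e f → L f

  SameClassSet : ClassSet → ClassSet → Set
  SameClassSet L K = ∀ e → (L e → K e) × (K e → L e)

  Orthogonal : Edge → Edge → Set
  Orthogonal e f = ∃[ u ] ∃[ v ] ∃[ y ] ∃[ x ] Σ (Cycle4 u v y x) λ where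
    (puv , pvy , pyx , pxu , _ , _) →
      Θ (u , v , puv) e × Θ (x , y , sym y x pyx) e ×
      Θ (u , x , sym x u pxu) f × Θ (v , y , pvy) f

  IsPOF : ClassSet → Set
  IsPOF L = IsClassSet L × (∀ e f → L e → L f → ¬ Θ e f → Orthogonal e f)

  Disjoint : ClassSet → ClassSet → Set
  Disjoint L K = ∀ e → ¬ (L e × K e)

  σ : V → V → ClassSet
  σ x y e = Separates e x y

  Ladder : V → V → ClassSet
  Ladder x y e = σ x y e × ∃[ z ] Σ (Adj x z) λ p → Θ (x , z , p) e

  module Based (v₀ : V) where

    Oriented : V → V → Set
    Oriented x y = ∃[ a ] ∃[ b ] (Dist v₀ x a × Dist v₀ y b × a < b)

    Outgoing : V → ClassSet → Set
    Outgoing m L = ∀ e → L e → ∃[ y ] Σ (Adj m y) λ p → Θ (m , y , p) e × Oriented m y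

    PhiVals : V → ClassSet → ℕ → Set
    PhiVals m L k = ∃[ v ] (InI v₀ v m × SameClassSet (Ladder m v) L × Dist m v k)

    IsPhi : V → ClassSet → ℕ → Set
    IsPhi m L k = IsMax (PhiVals m L) k

    -- values d(u,v) with m(u,v,v₀) = m ; Υ(m) is their max
    UpsVals : V → ℕ → Set
    UpsVals m k = ∃[ u ] ∃[ v ] (Med u v v₀ m × Dist u v k)

    PhiSumVals : V → ℕ → Set₁
    PhiSumVals m k = Σ ClassSet λ L → Σ ClassSet λ L* →
      IsPOF L × IsPOF L* × Outgoing m L × Outgoing m L* × Disjoint L L* ×
      ∃[ a ] ∃[ b ] (IsPhi m L a × IsPhi m L* b × k ≡ a + b)

    MaxPhiSumVals : ℕ → Set₁
    MaxPhiSumVals k = ∃[ m ] IsMax (PhiSumVals m) k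

  DiamVals : ℕ → Set
  DiamVals k = ∃[ u ] ∃[ v ] Dist u v k

-- For a vertex m choose u, v with m(u,v,v₀) = m at maximal distance Υ(m). As m lies in
-- I(u,v), I(v₀,u) and I(v₀,v), the ladder sets L_{m,u} and L_{m,v} are disjoint POFs outgoing
-- from m. Conversely, if L_{m,w} and L_{m,w*} are disjoint then m ∈ I(w,w*), for otherwise the
-- first edge from m towards m(m,w,w*) lies in both; so when also m ∈ I(v₀,w) ∩ I(v₀,w*), m is
-- the median of w, w*, v₀ and d(m,w) + d(m,w*) = d(w,w*) ≤ Υ(m). This gives
-- φ(m,L_{m,u}) = d(m,u), φ(m,L_{m,v}) = d(m,v) and the formula for Υ(m); the diameter is Υ at the
-- median of a diametral pair and v₀. Throughout, the Θ-class of an edge ab separates exactly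
-- W(a,b) = {z : d(z,a) < d(z,b)} from W(b,a), by the Djoković–Winkler ladder argument built
-- on the quadrangle condition.

module Submission where

open import Defs
open import Data.Bool.Properties using (T?; T-irrelevant)
open import Data.Empty using (⊥; ⊥-elim)
open import Data.Fin using (Fin)
import Data.Fin.Properties as Fin
open import Data.List using (List; filter; allFin; cartesianProduct)
open import Data.List.Extrema.Nat using (argmax; argmax-all; f[xs]≤f[argmax])
open import Data.List.Membership.Propositional using (_∈_)
open import Data.List.Membership.Propositional.Properties
  using (∈-allFin; ∈-filter⁺; ∈-cartesianProduct⁺)
open import Data.List.Relation.Unary.All using (lookup)
open import Data.List.Relation.Unary.All.Properties using (all-filter)
open import Data.Nat using (ℕ; zero; suc; _+_; _≤_; _<_; s≤s; z≤n)
open import Data.Nat.Induction using (<-rec)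
open import Data.Nat.Properties
open import Data.Product using (Σ; ∃-syntax; _×_; _,_; proj₁; proj₂; uncurry)
open import Data.Sum using (_⊎_; inj₁; inj₂; [_,_]′)
open import Data.Unit using (⊤; tt)
open import Function using (id; _∘_)
open import Relation.Binary.Definitions using (tri<; tri≈; tri>)
open import Relation.Binary.PropositionalEquality
open import Relation.Nullary using (¬_; Dec; yes; no)
open import Relation.Nullary.Decidable using (map′; _×-dec_; decidable-stable)
open import Relation.Unary using (Pred; Decidable)

module _ {p} {P : Pred ℕ p} (P? : Decidable P) where

  minimal : ∀ k → P k → ∃[ m ] (P m × (∀ j → P j → m ≤ j))
  minimal = <-rec _ search
    where
    search : ∀ k → (∀ {j} → j < k → P j → ∃[ m ] (P m × (∀ i → P i → m ≤ i))) →
             P k → ∃[ m ] (P m × (∀ i → P i → m ≤ i))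
    search k smaller pk with anyUpTo? P? k
    ... | yes (j , j<k , pj) = smaller j<k pj
    ... | no none = k , pk , λ i pi → ≮⇒≥ (λ i<k → none (i , i<k , pi))

module _ {a p} {A : Set a} {P : Pred A p} (P? : Decidable P) (f : A → ℕ) where

  maximise : (xs : List A) → (∀ {x} → P x → x ∈ xs) →
             ∀ {x} → P x → ∃[ y ] (P y × (∀ z → P z → f z ≤ f y))
  maximise xs complete {x} px =
    argmax f x ys , argmax-all f px (all-filter P? xs) ,
    λ z pz → lookup (f[xs]≤f[argmax] {f = f} x ys) (∈-filter⁺ P? (complete pz) pz)
    where
    ys : List A
    ys = filter P? xs

n≢2+n : ∀ n → n ≢ suc (suc n)
n≢2+n n e = <-irrefl e (n≤1+n (suc n))

double≢1 : ∀ n → n + n ≢ 1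
double≢1 (suc n) e = m+1+n≢0 n (suc-injective e)

double≡2⇒≡1 : ∀ {n} → n + n ≡ 2 → n ≡ 1
double≡2⇒≡1 {suc zero} _ = refl
double≡2⇒≡1 {suc (suc n)} e = ⊥-elim (m+1+n≢0 n (suc-injective (suc-injective e)))

module Metric (G : Graph) (connected : Connected G) where

  infix 4 _~_
  _~_ : V G → V G → Set
  _~_ = Adj G

  ~-sym : ∀ {u v} → u ~ v → v ~ u
  ~-sym {u} {v} = Graph.sym G u v

  walk? : ∀ k u v → Dec (Walk G u v k)
  walk? zero u v = map′ (λ { refl → here }) (λ { here → refl }) (u Fin.≟ v)
  walk? (suc k) u v =
    map′ (λ (_ , p , r) → step p r) (λ { (step {w = w} p r) → w , p , r })
         (Fin.any? λ w → T? (Graph.adj G u w) ×-dec walk? k w v)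

  opaque
    shortest-walk : ∀ u v → ∃[ k ] Dist G u v k
    shortest-walk u v = uncurry (minimal (λ k → walk? k u v)) (connected u v)

  d : V G → V G → ℕ
  d u v = proj₁ (shortest-walk u v)

  d-Dist : ∀ u v → Dist G u v (d u v)
  d-Dist u v = proj₂ (shortest-walk u v)

  shortest : ∀ u v → Walk G u v (d u v)
  shortest u v = proj₁ (d-Dist u v)

  d-minimal : ∀ {u v k} → Walk G u v k → d u v ≤ k
  d-minimal {u} {v} w = proj₂ (d-Dist u v) _ w

  Dist⇒≡d : ∀ {u v k} → Dist G u v k → k ≡ d u v
  Dist⇒≡d {u} {v} (w , min) = ≤-antisym (min _ (shortest u v)) (d-minimal w)

  _▷_ : ∀ {u v w k} → Walk G u v k → v ~ w → Walk G u w (suc k)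
  here ▷ q = step q here
  step p r ▷ q = step p (r ▷ q)

  reverse : ∀ {u v k} → Walk G u v k → Walk G v u k
  reverse here = here
  reverse (step p r) = reverse r ▷ ~-sym p

  _++_ : ∀ {u v w j k} → Walk G u v j → Walk G v w k → Walk G u w (j + k)
  here ++ r = r
  step p q ++ r = step p (q ++ r)

  d-sym : ∀ u v → d u v ≡ d v u
  d-sym u v = ≤-antisym (d-minimal (reverse (shortest v u))) (d-minimal (reverse (shortest u v)))

  d-triangle : ∀ u v w → d u w ≤ d u v + d v w
  d-triangle u v w = d-minimal (shortest u v ++ shortest v w)

  d-refl : ∀ u → d u u ≡ 0
  d-refl u = n≤0⇒n≡0 (d-minimal here)

  d≡0⇒≡ : ∀ {u v} → d u v ≡ 0 → u ≡ v
  d≡0⇒≡ {u} {v} e = length-0 (subst (Walk G u v) e (shortest u v))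
    where
    length-0 : Walk G u v 0 → u ≡ v
    length-0 here = refl

  d≡1⇒~ : ∀ {u v} → d u v ≡ 1 → u ~ v
  d≡1⇒~ {u} {v} e = length-1 (subst (Walk G u v) e (shortest u v))
    where
    length-1 : Walk G u v 1 → u ~ v
    length-1 (step p here) = p

  ~⇒d≡1 : ∀ {u v} → u ~ v → d u v ≡ 1
  ~⇒d≡1 {u} {v} p = ≤-antisym (d-minimal (step p here))
    (n≢0⇒n>0 λ e → Graph.irrefl G u (subst (u ~_) (sym (d≡0⇒≡ e)) p))

  ~⇒d≤sucʳ : ∀ {u v} → u ~ v → ∀ z → d z v ≤ suc (d z u)
  ~⇒d≤sucʳ {u} {v} p z = begin
    d z v         ≤⟨ d-triangle z u v ⟩
    d z u + d u v ≡⟨ cong (d z u +_) (~⇒d≡1 p) ⟩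
    d z u + 1     ≡⟨ +-comm (d z u) 1 ⟩
    suc (d z u)   ∎
    where open ≤-Reasoning

  ~⇒d≤sucˡ : ∀ {u v} → u ~ v → ∀ z → d v z ≤ suc (d u z)
  ~⇒d≤sucˡ {u} {v} p z = subst₂ (λ a b → a ≤ suc b) (d-sym z v) (d-sym z u) (~⇒d≤sucʳ p z)

  step-toward : ∀ {x t k} → d x t ≡ suc k → ∃[ x' ] (x ~ x' × d x' t ≡ k)
  step-toward {x} {t} {k} e with subst (Walk G x t) e (shortest x t)
  ... | step {w = x'} p r =
    x' , p , ≤-antisym (d-minimal r) (≤-pred (subst (_≤ suc (d x' t)) e (~⇒d≤sucˡ (~-sym p) t)))

  distance-gap⇒≢ : ∀ {x y t k} → d x t ≡ suc (suc k) → d y t ≡ k → x ≢ y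
  distance-gap⇒≢ ex ey refl = n≢2+n _ (trans (sym ey) ex)

  distance-gap⇒≁ : ∀ {x y t k} → d x t ≡ suc (suc k) → d y t ≡ k → ¬ y ~ x
  distance-gap⇒≁ {x} {y} {t} ex ey yx =
    1+n≰n (subst₂ (λ a b → a ≤ suc b) ex ey (~⇒d≤sucˡ yx t))

  d≡2 : ∀ {p q r} → r ~ p → r ~ q → p ≢ q → ¬ p ~ q → d p q ≡ 2
  d≡2 {p} {q} {r} rp rq p≢q p≁q with d p q in e | upper-bound
    where
    upper-bound : d p q ≤ 2
    upper-bound = subst₂ (λ a b → d p q ≤ a + b)
      (trans (d-sym p r) (~⇒d≡1 rp)) (~⇒d≡1 rq) (d-triangle p r q)
  ... | 0 | _ = ⊥-elim (p≢q (d≡0⇒≡ e))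
  ... | 1 | _ = ⊥-elim (p≁q (d≡1⇒~ e))
  ... | 2 | _ = refl
  ... | suc (suc (suc _)) | s≤s (s≤s ())

  farthest-pair : ∀ {P : V G → V G → Set} → (∀ u v → Dec (P u v)) → ∀ {u v} → P u v →
                  ∃[ x ] ∃[ y ] (P x y × (∀ x' y' → P x' y' → d x' y' ≤ d x y))
  farthest-pair {P} P? puv with maximise (uncurry P?) (uncurry d) pairs complete puv
    where
    pairs : List (V G × V G)
    pairs = cartesianProduct (allFin (Graph.n G)) (allFin (Graph.n G))
    complete : ∀ {xy} → uncurry P xy → xy ∈ pairs
    complete {x , y} _ = ∈-cartesianProduct⁺ (∈-allFin x) (∈-allFin y)
  ... | (x , y) , pxy , far = x , y , pxy , λ x' y' → far (x' , y')

  Between : V G → V G → V G → Set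
  Between u v w = d u w + d w v ≡ d u v

  InI⇒Between : ∀ {u v w} → InI G u v w → Between u v w
  InI⇒Between (_ , _ , _ , Da , Db , Dc , e) rewrite Dist⇒≡d Da | Dist⇒≡d Db | Dist⇒≡d Dc = e

  Between⇒InI : ∀ {u v w} → Between u v w → InI G u v w
  Between⇒InI {u} {v} {w} e = _ , _ , _ , d-Dist u w , d-Dist w v , d-Dist u v , e

  Between-sym : ∀ {u v w} → Between u v w → Between v u w
  Between-sym {u} {v} {w} b = begin
    d v w + d w u ≡⟨ +-comm (d v w) (d w u) ⟩
    d w u + d v w ≡⟨ cong₂ _+_ (d-sym w u) (d-sym v w) ⟩
    d u w + d w v ≡⟨ b ⟩
    d u v         ≡⟨ d-sym u v ⟩
    d v u         ∎
    where open ≡-Reasoning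

module Median (G : Graph) (median : IsMedianGraph G) where
  open Metric G (proj₁ median) public

  med : V G → V G → V G → V G
  med x y z = proj₁ (proj₂ median x y z)

  med-between₁ : ∀ x y z → Between x y (med x y z)
  med-between₁ x y z = InI⇒Between (proj₁ (proj₁ (proj₂ (proj₂ median x y z))))

  med-between₂ : ∀ x y z → Between y z (med x y z)
  med-between₂ x y z = InI⇒Between (proj₁ (proj₂ (proj₁ (proj₂ (proj₂ median x y z)))))

  med-between₃ : ∀ x y z → Between z x (med x y z)
  med-between₃ x y z = InI⇒Between (proj₂ (proj₂ (proj₁ (proj₂ (proj₂ median x y z)))))

  med-unique : ∀ {x y z w} → Between x y w → Between y z w → Between z x w → w ≡ med x y z
  med-unique {x} {y} {z} {w} b₁ b₂ b₃ =
    proj₂ (proj₂ (proj₂ median x y z)) w (Between⇒InI b₁ , Between⇒InI b₂ , Between⇒InI b₃)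

  Med⇒med≡ : ∀ {x y z w} → Med G x y z w → med x y z ≡ w
  Med⇒med≡ (i₁ , i₂ , i₃) = sym (med-unique (InI⇒Between i₁) (InI⇒Between i₂) (InI⇒Between i₃))

  med≡⇒Med : ∀ {x y z w} → med x y z ≡ w → Med G x y z w
  med≡⇒Med {x} {y} {z} refl =
    Between⇒InI (med-between₁ x y z) , Between⇒InI (med-between₂ x y z) , Between⇒InI (med-between₃ x y z)

  med-swap : ∀ x y z → med x y z ≡ med y x z
  med-swap x y z = med-unique (Between-sym (med-between₁ x y z))
    (Between-sym (med-between₃ x y z)) (Between-sym (med-between₂ x y z))

  med-idem : ∀ x z → med x x z ≡ x
  med-idem x z = sym (med-unique (cong (_+ d x x) (d-refl x)) (cong (_+ d x z) (d-refl x))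
    (trans (cong (d z x +_) (d-refl x)) (+-identityʳ (d z x))))

  med-halves : ∀ {p q t} → d t p ≡ d t q → d (med p q t) q + d (med p q t) q ≡ d p q
  med-halves {p} {q} {t} e = begin
    d c q + d c q ≡⟨ cong (_+ d c q) (trans (sym c-equidistant) (d-sym c p)) ⟩
    d p c + d c q ≡⟨ med-between₁ p q t ⟩
    d p q         ∎
    where
    open ≡-Reasoning
    c : V G
    c = med p q t
    c-equidistant : d c p ≡ d c q
    c-equidistant = +-cancelˡ-≡ (d t c) _ _ (begin
      d t c + d c p ≡⟨ med-between₃ p q t ⟩
      d t p         ≡⟨ e ⟩
      d t q         ≡⟨ Between-sym (med-between₂ p q t) ⟨
      d t c + d c q ∎)

  ~⇒d≢ : ∀ {u v} → u ~ v → ∀ z → d z u ≢ d z v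
  ~⇒d≢ {u} {v} p z e = double≢1 (d (med u v z) v) (trans (med-halves e) (~⇒d≡1 p))

  ~⇒d-suc : ∀ {u v} → u ~ v → ∀ z → d z v ≡ suc (d z u) ⊎ d z u ≡ suc (d z v)
  ~⇒d-suc {u} {v} p z with <-cmp (d z u) (d z v)
  ... | tri< lt _ _ = inj₁ (≤-antisym (~⇒d≤sucʳ p z) lt)
  ... | tri≈ _ e _ = ⊥-elim (~⇒d≢ p z e)
  ... | tri> _ _ gt = inj₂ (≤-antisym (~⇒d≤sucʳ (~-sym p) z) gt)

  quadrangle : ∀ {p q t} → d p q ≡ 2 → d t p ≡ d t q →
               ∃[ c ] (p ~ c × c ~ q × suc (d t c) ≡ d t q)
  quadrangle {p} {q} {t} pq e = c , d≡1⇒~ pc , d≡1⇒~ cq , (begin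
    suc (d t c)   ≡⟨ +-comm 1 (d t c) ⟩
    d t c + 1     ≡⟨ cong (d t c +_) cq ⟨
    d t c + d c q ≡⟨ Between-sym (med-between₂ p q t) ⟩
    d t q         ∎)
    where
    open ≡-Reasoning
    c : V G
    c = med p q t
    cq : d c q ≡ 1
    cq = double≡2⇒≡1 (trans (med-halves e) pq)
    pc : d p c ≡ 1
    pc = +-cancelʳ-≡ (d c q) _ _ (trans (med-between₁ p q t) (trans pq (cong (1 +_) (sym cq))))

  common-neighbour≡med : ∀ {p q t x} → x ~ p → x ~ q → d p q ≡ 2 →
                         d p t ≡ suc (d x t) → d q t ≡ suc (d x t) → x ≡ med p q t
  common-neighbour≡med {p} {q} {t} {x} xp xq pq pt qt = med-unique
    (trans (cong₂ _+_ (~⇒d≡1 (~-sym xp)) (~⇒d≡1 xq)) (sym pq))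
    (trans (cong (_+ d x t) (~⇒d≡1 (~-sym xq))) (sym qt))
    (trans (cong₂ _+_ (d-sym t x) (~⇒d≡1 xp)) (trans (+-comm (d x t) 1) (trans (sym pt) (d-sym p t))))

  W : V G → V G → V G → Set
  W a b z = d z a < d z b

  W-self : ∀ {a b} → a ~ b → W a b a
  W-self {a} ab = subst₂ _<_ (sym (d-refl a)) (sym (trans (d-sym a _) (~⇒d≡1 (~-sym ab)))) (s≤s z≤n)

  W-total : ∀ {a b} → a ~ b → ∀ z → W a b z ⊎ W b a z
  W-total ab z with ~⇒d-suc ab z
  ... | inj₁ e = inj₁ (≤-reflexive (sym e))
  ... | inj₂ e = inj₂ (≤-reflexive (sym e))

  W⇒d≡suc : ∀ {a b z} → a ~ b → W a b z → d z b ≡ suc (d z a)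
  W⇒d≡suc ab w with ~⇒d-suc ab _
  ... | inj₁ e = e
  ... | inj₂ e = ⊥-elim (<-asym w (≤-reflexive (sym e)))

  W-closer : ∀ {a b x x'} → a ~ b → W a b x → x ~ x' → d x' a < d x a → W a b x'
  W-closer {a} {b} {x} {x'} ab wx xx' lt = ≤-pred (begin
    suc (suc (d x' a)) ≤⟨ s≤s lt ⟩
    suc (d x a)        ≡⟨ W⇒d≡suc ab wx ⟨
    d x b              ≤⟨ ~⇒d≤sucˡ (~-sym xx') b ⟩
    suc (d x' b)       ∎)
    where open ≤-Reasoning

  crossing-equidistant : ∀ {a b p r} → a ~ b → p ~ r → W a b p → W b a r → d p a ≡ d r b
  crossing-equidistant ab pr wp wr = ≤-antisym (half ab pr wp) (half (~-sym ab) (~-sym pr) wr)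
    where
    half : ∀ {a b p r} → a ~ b → p ~ r → W a b p → d p a ≤ d r b
    half {a} {b} {p} {r} ab pr wp =
      ≤-pred (subst (_≤ suc (d r b)) (W⇒d≡suc ab wp) (~⇒d≤sucˡ (~-sym pr) b))

  -- Otherwise r and the common neighbour of p, q that is closer to a would both be med p q b.
  W-neighbour-unique : ∀ {a b r p q} → a ~ b → W b a r → r ~ p → r ~ q →
                       W a b p → W a b q → p ≡ q
  W-neighbour-unique {a} {b} {r} {p} {q} ab wr rp rq wp wq =
    decidable-stable (p Fin.≟ q) λ p≢q → two-medians p≢q (quadrangle (pq p≢q) (trans ap (sym aq)))
    where
    k : ℕ
    k = d r b
    ap : d a p ≡ k
    ap = trans (d-sym a p) (crossing-equidistant ab (~-sym rp) wp wr)
    aq : d a q ≡ k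
    aq = trans (d-sym a q) (crossing-equidistant ab (~-sym rq) wq wr)
    pq : p ≢ q → d p q ≡ 2
    pq p≢q = d≡2 rp rq p≢q (λ p~q → ~⇒d≢ p~q a (trans ap (sym aq)))
    pb : d p b ≡ suc k
    pb = trans (W⇒d≡suc ab wp) (cong suc (trans (d-sym p a) ap))
    qb : d q b ≡ suc k
    qb = trans (W⇒d≡suc ab wq) (cong suc (trans (d-sym q a) aq))
    two-medians : p ≢ q → ∃[ m ] (p ~ m × m ~ q × suc (d a m) ≡ d a q) → ⊥
    two-medians p≢q (m , pm , mq , am) = distance-gap⇒≢ ra refl (trans r≡med (sym m≡med))
      where
      ma : suc (d m a) ≡ k
      ma = trans (cong suc (d-sym m a)) (trans am aq)
      ra : d r a ≡ suc (suc (d m a))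
      ra = trans (W⇒d≡suc (~-sym ab) wr) (cong suc (sym ma))
      mb : d m b ≡ k
      mb = ≤-antisym (subst (d m b ≤_) ma (~⇒d≤sucʳ ab m))
                     (≤-pred (subst (_≤ suc (d m b)) pb (~⇒d≤sucˡ (~-sym pm) b)))
      r≡med : r ≡ med p q b
      r≡med = common-neighbour≡med rp rq (pq p≢q) pb qb
      m≡med : m ≡ med p q b
      m≡med = common-neighbour≡med (~-sym pm) mq (pq p≢q)
                (trans pb (cong suc (sym mb))) (trans qb (cong suc (sym mb)))

  Splits : V G → V G → V G → V G → Set
  Splits a b u v = (W a b u × W b a v) ⊎ (W b a u × W a b v)

  Splits-swap : ∀ {a b u v} → Splits a b u v → Splits a b v u
  Splits-swap (inj₁ (wu , wv)) = inj₂ (wv , wu)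
  Splits-swap (inj₂ (wu , wv)) = inj₁ (wv , wu)

  Cycle4-swap : ∀ {u v y x} → Cycle4 G u v y x → Cycle4 G x y v u
  Cycle4-swap (uv , vy , yx , xu , u≢y , v≢x) =
    ~-sym yx , ~-sym vy , ~-sym uv , ~-sym xu , v≢x ∘ sym , u≢y ∘ sym

  square-W : ∀ {a b u v y x} → a ~ b → Cycle4 G u v y x → W a b u → W b a v → W a b x × W b a y
  square-W {a} {b} {u} {v} {y} {x} ab (uv , vy , _ , xu , u≢y , v≢x) wu wv =
    [ id , (λ wx → ⊥-elim (v≢x (W-neighbour-unique (~-sym ab) wu uv (~-sym xu) wv wx))) ]′ (W-total ab x) ,
    [ (λ wy → ⊥-elim (u≢y (W-neighbour-unique ab wv (~-sym uv) vy wu wy))) , id ]′ (W-total ab y)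

  square-Splits : ∀ {a b u v y x} → a ~ b → Cycle4 G u v y x → Splits a b u v → Splits a b x y
  square-Splits ab c (inj₁ (wu , wv)) = inj₁ (square-W ab c wu wv)
  square-Splits ab c (inj₂ (wu , wv)) = inj₂ (square-W (~-sym ab) c wu wv)

  Crosses : V G → V G → Edge G → Set
  Crosses a b (u , v , _) = Splits a b u v

  Θ-preserves-Crosses : ∀ {a b e f} → a ~ b → Θ G e f →
                        (Crosses a b e → Crosses a b f) × (Crosses a b f → Crosses a b e)
  Θ-preserves-Crosses ab θ-refl = id , id
  Θ-preserves-Crosses ab (θ-flip _ _) = Splits-swap , Splits-swap
  Θ-preserves-Crosses ab (θ-step c t) =
    proj₁ (Θ-preserves-Crosses ab t) ∘ square-Splits ab c ,
    square-Splits ab (Cycle4-swap c) ∘ proj₂ (Θ-preserves-Crosses ab t)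
  Θ-preserves-Crosses ab (θ-sym t) = proj₂ (Θ-preserves-Crosses ab t) , proj₁ (Θ-preserves-Crosses ab t)
  Θ-preserves-Crosses ab (θ-trans t s) =
    proj₁ (Θ-preserves-Crosses ab s) ∘ proj₁ (Θ-preserves-Crosses ab t) ,
    proj₂ (Θ-preserves-Crosses ab t) ∘ proj₂ (Θ-preserves-Crosses ab s)

  W-inner-¬Θ : ∀ {a b u v} (ab : a ~ b) (uv : u ~ v) → W a b u → W a b v → ¬ Θ G (u , v , uv) (a , b , ab)
  W-inner-¬Θ ab uv wu wv t with proj₂ (Θ-preserves-Crosses ab t) (inj₁ (W-self ab , W-self (~-sym ab)))
  ... | inj₁ (_ , wv') = <-asym wv wv'
  ... | inj₂ (wu' , _) = <-asym wu wu'

  Θ-irrelevant : ∀ {u v} (p q : u ~ v) → Θ G (u , v , p) (u , v , q)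
  Θ-irrelevant {u} {v} p q = subst (λ q → Θ G (u , v , p) (u , v , q)) (T-irrelevant p q) θ-refl

  crossing-step : ∀ {a b x y k} → a ~ b → x ~ y → W a b x → W b a y → d x a ≡ suc k →
                  ∃[ x' ] ∃[ y' ] Σ (x' ~ y') λ x'y' →
                    Cycle4 G x y y' x' × W a b x' × W b a y' × d x' a ≡ k
  crossing-step {a} {b} {x} {y} {k} ab xy wx wy xa with step-toward xa
  ... | x' , xx' , x'a = x' , rung (quadrangle {t = b} (d≡2 xx' xy (y≢x' ∘ sym) (distance-gap⇒≁ ya x'a))
                                                      (trans (d-sym b x') (trans x'b (trans (sym yb) (d-sym y b)))))
    where
    wx' : W a b x'
    wx' = W-closer ab wx xx' (subst₂ _<_ (sym x'a) (sym xa) (n<1+n k))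
    yb : d y b ≡ suc k
    yb = trans (sym (crossing-equidistant ab xy wx wy)) xa
    ya : d y a ≡ suc (suc k)
    ya = trans (W⇒d≡suc (~-sym ab) wy) (cong suc yb)
    x'b : d x' b ≡ suc k
    x'b = trans (W⇒d≡suc ab wx') (cong suc x'a)
    y≢x' : y ≢ x'
    y≢x' = distance-gap⇒≢ ya x'a
    rung : ∃[ y' ] (x' ~ y' × y' ~ y × suc (d b y') ≡ d b y) →
           ∃[ y' ] Σ (x' ~ y') λ x'y' → Cycle4 G x y y' x' × W a b x' × W b a y' × d x' a ≡ k
    rung (y' , x'y' , y'y , by') = y' , x'y' , square , wx' , wy' , x'a
      where
      y'b : d y' b ≡ k
      y'b = suc-injective (trans (cong suc (d-sym y' b)) (trans by' (trans (d-sym b y) yb)))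
      wy' : W b a y'
      wy' = W-closer (~-sym ab) wy (~-sym y'y) (subst₂ _<_ (sym y'b) (sym yb) (n<1+n k))
      xb : d x b ≡ suc (suc k)
      xb = trans (W⇒d≡suc ab wx) (cong suc xa)
      square : Cycle4 G x y y' x'
      square = xy , ~-sym y'y , ~-sym x'y' , ~-sym xx' , distance-gap⇒≢ xb y'b , y≢x'

  crossing⇒Θ : ∀ {a b x y} (ab : a ~ b) (xy : x ~ y) → W a b x → W b a y → Θ G (x , y , xy) (a , b , ab)
  crossing⇒Θ {a} {b} {x} ab xy wx wy = go (d x a) xy wx wy refl
    where
    go : ∀ k {x y} (xy : x ~ y) → W a b x → W b a y → d x a ≡ k → Θ G (x , y , xy) (a , b , ab)
    go zero xy wx wy xa
      with d≡0⇒≡ xa | d≡0⇒≡ (trans (sym (crossing-equidistant ab xy wx wy)) xa)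
    ... | refl | refl = Θ-irrelevant xy ab
    go (suc k) xy wx wy xa with crossing-step ab xy wx wy xa
    ... | _ , _ , x'y' , square , wx' , wy' , x'a = θ-step square (go k x'y' wx' wy' x'a)

  WalkAvoid-Θ : ∀ {e f u v} → Θ G e f → WalkAvoid G e u v → WalkAvoid G f u v
  WalkAvoid-Θ ef here = here
  WalkAvoid-Θ ef (step p ¬θ r) = step p (λ t → ¬θ (θ-trans t (θ-sym ef))) (WalkAvoid-Θ ef r)

  _++ᵃ_ : ∀ {e u v w} → WalkAvoid G e u v → WalkAvoid G e v w → WalkAvoid G e u w
  here ++ᵃ r = r
  step p ¬θ q ++ᵃ r = step p ¬θ (q ++ᵃ r)

  reverseᵃ : ∀ {e u v} → WalkAvoid G e u v → WalkAvoid G e v u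
  reverseᵃ here = here
  reverseᵃ (step p ¬θ r) = reverseᵃ r ++ᵃ step (~-sym p) (¬θ ∘ θ-trans (θ-flip p (~-sym p))) here

  W-stays : ∀ {a b u v} (ab : a ~ b) → WalkAvoid G (a , b , ab) u v → W a b u → W a b v
  W-stays ab here wu = wu
  W-stays ab (step {w = w} p ¬θ r) wu =
    W-stays ab r ([ id , (λ ww → ⊥-elim (¬θ (crossing⇒Θ ab p wu ww))) ]′ (W-total ab w))

  W-walk-to : ∀ {a b x} (ab : a ~ b) → W a b x → WalkAvoid G (a , b , ab) x a
  W-walk-to {a} {b} {x} ab wx = go (d x a) wx refl
    where
    go : ∀ k {x} → W a b x → d x a ≡ k → WalkAvoid G (a , b , ab) x a
    go zero wx xa with d≡0⇒≡ xa
    ... | refl = here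
    go (suc k) wx xa with step-toward xa
    ... | x' , xx' , x'a = step xx' (W-inner-¬Θ ab xx' wx wx') (go k wx' x'a)
      where
      wx' : W a b x'
      wx' = W-closer ab wx xx' (subst₂ _<_ (sym x'a) (sym xa) (n<1+n k))

  W-walk : ∀ {a b x y} (ab : a ~ b) → W a b x → W a b y → WalkAvoid G (a , b , ab) x y
  W-walk ab wx wy = W-walk-to ab wx ++ᵃ reverseᵃ (W-walk-to ab wy)

  Separates-Θ : ∀ {e f x y} → Θ G e f → Separates G e x y → Separates G f x y
  Separates-Θ ef s = s ∘ WalkAvoid-Θ (θ-sym ef)

  Separates⇒Splits : ∀ {a b x y} (ab : a ~ b) → Separates G (a , b , ab) x y → Splits a b x y
  Separates⇒Splits {x = x} {y} ab s with W-total ab x | W-total ab y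
  ... | inj₁ wx | inj₁ wy = ⊥-elim (s (W-walk ab wx wy))
  ... | inj₁ wx | inj₂ wy = inj₁ (wx , wy)
  ... | inj₂ wx | inj₁ wy = inj₂ (wx , wy)
  ... | inj₂ wx | inj₂ wy = ⊥-elim (s (WalkAvoid-Θ (θ-flip (~-sym ab) ab) (W-walk (~-sym ab) wx wy)))

  W⇒Separates : ∀ {a b x y} (ab : a ~ b) → W a b x → W b a y → Separates G (a , b , ab) x y
  W⇒Separates ab wx wy r = <-asym (W-stays ab r wx) wy

  Between⇒W : ∀ {x m c z} → Between x m c → d c z < d c m → W z m x
  Between⇒W {x} {m} {c} {z} b lt = begin-strict
    d x z         ≤⟨ d-triangle x c z ⟩
    d x c + d c z <⟨ +-monoʳ-< (d x c) lt ⟩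
    d x c + d c m ≡⟨ b ⟩
    d x m         ∎
    where open ≤-Reasoning

  Between⇒¬W-both : ∀ {u v m z} → Between u v m → W z m u → W z m v → ⊥
  Between⇒¬W-both {u} {v} {m} {z} b wu wv = <-irrefl refl (begin-strict
    d u v         ≤⟨ d-triangle u z v ⟩
    d u z + d z v <⟨ +-mono-< wu (subst₂ _<_ (d-sym v z) (d-sym v m) wv) ⟩
    d u m + d m v ≡⟨ b ⟩
    d u v         ∎)
    where open ≤-Reasoning

  W⇒Ladder : ∀ {m z v} (p : m ~ z) → W z m v → Ladder G m v (m , z , p)
  W⇒Ladder p wv = W⇒Separates p (W-self p) wv , _ , p , θ-refl

  Ladder⇒W : ∀ {m z v e} (p : m ~ z) → Θ G (m , z , p) e → Separates G e m v → W z m v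
  Ladder⇒W {m} {z} p th s with Separates⇒Splits p (Separates-Θ (θ-sym th) s)
  ... | inj₁ (_ , wv) = wv
  ... | inj₂ (wm , _) = ⊥-elim (n≮0 (subst (d m z <_) (d-refl m) wm))

  Ladder-disjoint : ∀ {m u v e} → Between u v m → Ladder G m u e → Ladder G m v e → ⊥
  Ladder-disjoint b (su , _ , p , th) (sv , _) = Between⇒¬W-both b (Ladder⇒W p th su) (Ladder⇒W p th sv)

  disjoint-ladders⇒Between : ∀ {m v w} → (∀ e → Ladder G m v e → Ladder G m w e → ⊥) → Between v w m
  disjoint-ladders⇒Between {m} {v} {w} disjoint with d m (med m v w) in mc
  ... | zero = subst (Between v w) (sym (d≡0⇒≡ mc)) (med-between₂ m v w)
  ... | suc k with step-toward mc
  ...   | z , mz , zc = ⊥-elim (disjoint (m , z , mz)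
          (W⇒Ladder mz (Between⇒W (Between-sym (med-between₁ m v w)) closer))
          (W⇒Ladder mz (Between⇒W (med-between₃ m v w) closer)))
    where
    closer : d (med m v w) z < d (med m v w) m
    closer = subst₂ _<_ (trans (sym zc) (d-sym z _)) (trans (sym mc) (d-sym m _)) (n<1+n k)

  Cycle4-mirror : ∀ {u v y x} → Cycle4 G u v y x → Cycle4 G u x y v
  Cycle4-mirror (uv , vy , yx , xu , u≢y , v≢x) =
    ~-sym xu , ~-sym yx , ~-sym vy , ~-sym uv , u≢y , v≢x ∘ sym

  ladder-square : ∀ {m z z' u} (p : m ~ z) (p' : m ~ z') → W z m u → W z' m u → z ≢ z' →
                  ∃[ c ] Cycle4 G m z c z'
  ladder-square {m} {z} {z'} {u} p p' wz wz' z≢z' =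
    close (quadrangle (d≡2 p p' z≢z' (λ zz' → ~⇒d≢ zz' u uz≡uz')) uz≡uz')
    where
    um : d u m ≡ suc (d u z')
    um = W⇒d≡suc (~-sym p') wz'
    uz≡uz' : d u z ≡ d u z'
    uz≡uz' = suc-injective (trans (sym (W⇒d≡suc (~-sym p) wz)) um)
    close : ∃[ c ] (z ~ c × c ~ z' × suc (d u c) ≡ d u z') → ∃[ c ] Cycle4 G m z c z'
    close (c , zc , cz' , uc) = c , p , zc , cz' , ~-sym p' , distance-gap⇒≢ mu refl , z≢z'
      where
      mu : d m u ≡ suc (suc (d c u))
      mu = trans (d-sym m u) (trans um (cong suc (trans (sym uc) (cong suc (d-sym u c)))))

  Ladder-POF : ∀ {m u} → IsPOF G (Ladder G m u)
  Ladder-POF {m} {u} = closed , orthogonal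
    where
    closed : IsClassSet G (Ladder G m u)
    closed e f (s , z , p , th) ef = Separates-Θ ef s , z , p , θ-trans th ef
    orthogonal : ∀ e f → Ladder G m u e → Ladder G m u f → ¬ Θ G e f → Orthogonal G e f
    orthogonal e f (se , z , p , th) (sf , z' , p' , th') ¬ef
      with ladder-square p p' (Ladder⇒W p th se) (Ladder⇒W p' th' sf) z≢z'
      where
      z≢z' : z ≢ z'
      z≢z' refl = ¬ef (θ-trans (θ-sym th) (θ-trans (Θ-irrelevant p p') th'))
    ... | c , square = _ , _ , c , _ , square ,
      θ-trans (Θ-irrelevant _ p) th , θ-trans (θ-sym (θ-step square θ-refl)) th ,
      θ-trans (Θ-irrelevant _ p') th' , θ-trans (θ-sym (θ-step (Cycle4-mirror square) θ-refl)) th'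

module Pointed (G : Graph) (median : IsMedianGraph G) (v₀ : V G) where
  open Median G median
  open Based G v₀

  Ladder-outgoing : ∀ {m u} → Between v₀ u m → Outgoing m (Ladder G m u)
  Ladder-outgoing {m} b e (su , z , p , th) = z , p , th , d v₀ m , d v₀ z , d-Dist v₀ m , d-Dist v₀ z ,
    [ id , (λ wv₀ → ⊥-elim (Between⇒¬W-both b wv₀ (Ladder⇒W p th su))) ]′ (W-total p v₀)

  Between-sum : ∀ {x y m} → Between x y m → d x y ≡ d m x + d m y
  Between-sum {x} {y} {m} b = trans (sym b) (cong (_+ d m y) (d-sym x m))

  ΥPair : V G → V G → V G → Set
  ΥPair m u v = med u v v₀ ≡ m × (∀ x y → med x y v₀ ≡ m → d x y ≤ d u v)

  ΥPair-exists : ∀ m → ∃[ u ] ∃[ v ] ΥPair m u v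
  ΥPair-exists m with farthest-pair (λ u v → med u v v₀ Fin.≟ m) (med-idem m v₀)
  ... | u , v , uvm , far = u , v , uvm , far

  ΥPair-swap : ∀ {m u v} → ΥPair m u v → ΥPair m v u
  ΥPair-swap {u = u} {v} (uvm , far) =
    trans (sym (med-swap u v v₀)) uvm , λ x y e → subst (_ ≤_) (d-sym u v) (far x y e)

  ΥPair⇒Between : ∀ {m u v} → ΥPair m u v → Between u v m
  ΥPair⇒Between {u = u} {v} (uvm , _) = subst (Between u v) uvm (med-between₁ u v v₀)

  ΥPair⇒Between₀ : ∀ {m u v} → ΥPair m u v → Between v₀ u m
  ΥPair⇒Between₀ {u = u} {v} (uvm , _) = subst (Between v₀ u) uvm (med-between₃ u v v₀)

  ΥPair⇒IsMax : ∀ {m u v} → ΥPair m u v → IsMax (UpsVals m) (d u v)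
  ΥPair⇒IsMax {u = u} {v} (uvm , far) = (u , v , med≡⇒Med uvm , d-Dist u v) ,
    λ j (x , y , M , D) → subst (_≤ d u v) (sym (Dist⇒≡d D)) (far x y (Med⇒med≡ M))

  ΥPair-bound : ∀ {m u v x y} → ΥPair m u v → Between v₀ x m → Between v₀ y m →
                (∀ e → Ladder G m x e → Ladder G m y e → ⊥) → d m x + d m y ≤ d m u + d m v
  ΥPair-bound {m} {u} {v} {x} {y} P@(_ , far) bx by disjoint = begin
    d m x + d m y ≡⟨ Between-sum xy ⟨
    d x y         ≤⟨ far x y (sym (med-unique xy (Between-sym by) bx)) ⟩
    d u v         ≡⟨ Between-sum (ΥPair⇒Between P) ⟩
    d m u + d m v ∎
    where
    open ≤-Reasoning
    xy : Between x y m
    xy = disjoint-ladders⇒Between disjoint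

  ΥPair⇒IsPhi : ∀ {m u v} → ΥPair m u v → IsPhi m (Ladder G m u) (d m u)
  ΥPair⇒IsPhi {m} {u} {v} P = (u , Between⇒InI (ΥPair⇒Between₀ P) , (λ _ → id , id) , d-Dist m u) ,
    λ j (x , I , same , D) → subst (_≤ d m u) (sym (Dist⇒≡d D)) (+-cancelʳ-≤ (d m v) _ _
      (ΥPair-bound P (InI⇒Between I) (ΥPair⇒Between₀ (ΥPair-swap P))
        (λ e lx lv → Ladder-disjoint (ΥPair⇒Between P) (proj₁ (same e) lx) lv)))

  ΥPair⇒PhiSumVals : ∀ {m u v} → ΥPair m u v → PhiSumVals m (d u v)
  ΥPair⇒PhiSumVals {m} {u} {v} P = Ladder G m u , Ladder G m v , Ladder-POF , Ladder-POF ,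
    Ladder-outgoing (ΥPair⇒Between₀ P) , Ladder-outgoing (ΥPair⇒Between₀ (ΥPair-swap P)) ,
    (λ e (lu , lv) → Ladder-disjoint (ΥPair⇒Between P) lu lv) ,
    d m u , d m v , ΥPair⇒IsPhi P , ΥPair⇒IsPhi (ΥPair-swap P) , Between-sum (ΥPair⇒Between P)

  PhiSumVals⇒≤ : ∀ {m u v j} → ΥPair m u v → PhiSumVals m j → j ≤ d u v
  PhiSumVals⇒≤ {m} {u} {v} P
    (_ , _ , _ , _ , _ , _ , disjoint , a , b , ((x , I , same , D) , _) , ((y , I* , same* , D*) , _) , refl) =
    begin
    a + b         ≡⟨ cong₂ _+_ (Dist⇒≡d D) (Dist⇒≡d D*) ⟩
    d m x + d m y ≤⟨ ΥPair-bound P (InI⇒Between I) (InI⇒Between I*)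
                       (λ e lx ly → disjoint e (proj₁ (same e) lx , proj₁ (same* e) ly)) ⟩
    d m u + d m v ≡⟨ Between-sum (ΥPair⇒Between P) ⟨
    d u v         ∎
    where open ≤-Reasoning

  Υ≡max-φ-sum : ∀ m → ∃[ k ] (IsMax (UpsVals m) k × IsMax (PhiSumVals m) k)
  Υ≡max-φ-sum m with ΥPair-exists m
  ... | u , v , P = d u v , ΥPair⇒IsMax P , ΥPair⇒PhiSumVals P , λ j → PhiSumVals⇒≤ P

  diam≡max-φ-sum : ∃[ k ] (IsMax (DiamVals G) k × IsMax MaxPhiSumVals k)
  diam≡max-φ-sum with farthest-pair {P = λ _ _ → ⊤} (λ _ _ → yes tt) {v₀} {v₀} tt
  ... | u , v , _ , far =
    d u v , ((u , v , d-Dist u v) , λ j (x , y , D) → subst (_≤ d u v) (sym (Dist⇒≡d D)) (far x y tt)) ,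
    (med u v v₀ , ΥPair⇒PhiSumVals P , λ j → PhiSumVals⇒≤ P) , bound
    where
    P : ΥPair (med u v v₀) u v
    P = refl , λ x y _ → far x y tt
    bound : ∀ j → MaxPhiSumVals j → j ≤ d u v
    bound j (m , phi , _) with ΥPair-exists m
    ... | x , y , Q = ≤-trans (PhiSumVals⇒≤ Q phi) (far x y tt)

corollary1 : (G : Graph) → IsMedianGraph G → (v₀ : Fin (Graph.n G)) →
    (∀ m → ∃[ k ] (IsMax (Based.UpsVals G v₀ m) k × IsMax (Based.PhiSumVals G v₀ m) k))
    × (∃[ k ] (IsMax (DiamVals G) k × IsMax (Based.MaxPhiSumVals G v₀) k))
corollary1 G median v₀ = Υ≡max-φ-sum , diam≡max-φ-sum
  where open Pointed G median v₀
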